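{- Let $G$ be a median graph with $n$ vertices and let $f:\mathbb{N}^*\to\mathbb{N}^*$ with $f(n)\ge 2$. Suppose every $\Theta$-class $E_i$ of $G$ is $f$-unbalanced, i.e. $\min\{|H_i'|,|H_i''|\}<n/f(n)$. Then there exists a unique vertex $v_0$ such that for every $\Theta$-class $E_i$, $v_0$ belongs to the majority halfspace of $E_i$.
   Context: Graphs are finite, simple, undirected, connected; $d$ is shortest-path distance. A graph is median if for every triple of distinct vertices $x,y,z$, $I(x,y)\cap I(y,z)\cap I(z,x)$ is a single vertex, where $I(u,v)=\{x:d(u,x)+d(x,v)=d(u,v)\}$. $\Theta$-classes: edges $uv,xy$ are $\Theta_0$-related if $uvyx$ is a 4-cycle with $uv,xy$ opposite; $\Theta$ is the reflexive-transitive closure of $\Theta_0$; removing a $\Theta$-class $E_i$ from a median graph leaves two connected components with vertex sets $H_i',H_i''$ (halfspaces). When $|H_i'|<|H_i''|$, $H_i''$ is the majority halfspace (and $H_i'$ the minority one), and symmetrically. -}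

module Defs where

open import Data.Nat using (ℕ; zero; suc; _+_; _*_; _≤_; _<_)
open import Data.Nat using () renaming (_⊓_ to min)
open import Data.Fin using (Fin)
open import Data.Fin.Subset using (Subset; _∈_; ∣_∣)
open import Data.Bool using (Bool; T)
open import Data.Product using (Σ; ∃; _×_; _,_)
open import Relation.Binary.PropositionalEquality using (_≡_; _≢_)
open import Relation.Binary.Construct.Closure.ReflexiveTransitive using (Star)
open import Relation.Nullary using (¬_)
open import Function.Bundles using (_⇔_)

record Graph (n : ℕ) : Set where
  field
    adj   : Fin n → Fin n → Bool
    sym   : ∀ u v → adj u v ≡ adj v u
    irrefl : ∀ u → ¬ T (adj u u)

module _ {n : ℕ} (G : Graph n) where
  open Graph G

  Adj : Fin n → Fin n → Set
  Adj u v = T (adj u v)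

  data Walk : Fin n → Fin n → ℕ → Set where
    here : ∀ {u} → Walk u u 0
    step : ∀ {u w v k} → Adj u w → Walk w v k → Walk u v (suc k)

  Connected : Set
  Connected = ∀ u v → ∃ λ k → Walk u v k

  Dist : Fin n → Fin n → ℕ → Set
  Dist u v k = Walk u v k × (∀ m → Walk u v m → k ≤ m)

  InInterval : Fin n → Fin n → Fin n → Set
  InInterval u v x = Σ ℕ λ a → Σ ℕ λ b → Σ ℕ λ c →
    Dist u x a × Dist x v b × Dist u v c × (a + b ≡ c)

  InAllThree : Fin n → Fin n → Fin n → Fin n → Set
  InAllThree x y z m = InInterval x y m × InInterval y z m × InInterval z x m

  IsMedian : Set
  IsMedian = Connected ×
    (∀ x y z → x ≢ y → y ≢ z → z ≢ x →
      Σ (Fin n) λ m → InAllThree x y z m × (∀ m' → InAllThree x y z m' → m' ≡ m))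

  Edge : Set
  Edge = Σ (Fin n) λ u → Σ (Fin n) λ v → Adj u v

  src tgt : Edge → Fin n
  src (u , _ , _) = u
  tgt (_ , v , _) = v

  -- Θ₀ on oriented edges: uv and xy are opposite sides of the 4-cycle u v y x
  Θ₀ : Edge → Edge → Set
  Θ₀ (u , v , _) (x , y , _) =
    Adj v y × Adj y x × Adj x u ×
    u ≢ v × u ≢ y × u ≢ x × v ≢ y × v ≢ x × y ≢ x

  Reverse : Edge → Edge → Set
  Reverse (u , v , _) (x , y , _) = (x ≡ v) × (y ≡ u)

  data Step : Edge → Edge → Set where
    θ₀  : ∀ {e e'} → Θ₀ e e' → Step e e'
    rev : ∀ {e e'} → Reverse e e' → Step e e'

  -- Θ : reflexive-transitive closure of Θ₀ on (unordered) edges;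
  -- an edge belongs to the Θ-class of e (in some/any orientation) iff Θ e e'.
  Θ : Edge → Edge → Set
  Θ = Star Step

  AdjMinus : Edge → Fin n → Fin n → Set
  AdjMinus e a b = Σ (Adj a b) λ p → ¬ Θ e (a , b , p)

  ReachMinus : Edge → Fin n → Fin n → Set
  ReachMinus e = Star (AdjMinus e)

  IsComponent : Edge → Fin n → Subset n → Set
  IsComponent e w S = ∀ x → (x ∈ S) ⇔ ReachMinus e w x

  -- the Θ-class of e is f-unbalanced: min(|H'|,|H''|) < n / f(n)
  -- (stated multiplicatively: min(|H'|,|H''|) * f(n) < n)
  Unbalanced : (ℕ → ℕ) → Edge → Set
  Unbalanced f e = ∀ H' H'' → IsComponent e (src e) H' → IsComponent e (tgt e) H'' →
    min ∣ H' ∣ ∣ H'' ∣ * f n < n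

  InMajority : Edge → Fin n → Set
  InMajority e v = ∀ H' H'' → IsComponent e (src e) H' → IsComponent e (tgt e) H'' →
    (∣ H' ∣ < ∣ H'' ∣ → v ∈ H'') × (∣ H'' ∣ < ∣ H' ∣ → v ∈ H')

-- Every edge ab of a median graph splits the vertices into W a b (the vertices closer to a)
-- and W b a, and these are exactly the two halfspaces of the Θ-class of ab: an edge leaving
-- W a b is Θ-related to ab, and Θ-related edges induce the same split.  Let v₀ minimise the
-- total distance Σ_u d(v₀, u).  If v₀ lay in a strictly smaller halfspace W a b, moving it to
-- its gate q in the convex set W b a would lower the distance to each vertex of W b a by
-- d(v₀, q) and raise the distance to each vertex of W a b by at most d(v₀, q), decreasing the
-- total.  If v ≠ v' both lie in all majority halfspaces, let vw be the first edge of a geodesic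
-- from v to v': neither of its halfspaces W v w ∋ v and W w v ∋ v' can be strictly smaller, so
-- both have n/2 vertices, which f(n) ≥ 2 forbids.

module Submission where

open import Defs
open import Level using (0ℓ)
open import Data.Bool using (true; false; T; if_then_else_)
open import Data.Bool.Properties using (T?; T-irrelevant)
open import Data.Empty using (⊥; ⊥-elim)
open import Data.Fin using (Fin; zero; suc) renaming (_≟_ to _≟ᶠ_)
open import Data.Fin.Properties using (any?)
open import Data.Fin.Subset using (Subset; _∈_; ∣_∣; ∁)
open import Data.Fin.Subset.Properties using (⊆-antisym; x∉p⇒x∈∁p; x∈∁p⇒x∉p; ∣∁p∣≡n∸∣p∣; ∣p∣≤n)
open import Data.Nat using (ℕ; zero; suc; _+_; _*_; _∸_; NonZero; ≢-nonZero; _≤_; _<_; z≤n; s≤s; _≟_; _<?_; _≤?_; _⊓_)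
open import Data.Nat.Properties
open import Data.Product using (Σ; _×_; _,_; proj₁; proj₂)
open import Data.Sum using (_⊎_; inj₁; inj₂; [_,_])
open import Data.Vec using ([]; _∷_; lookup; tabulate)
open import Data.Vec.Functional using (Vector)
open import Data.Vec.Properties using (lookup∘tabulate; []=⇒lookup; lookup⇒[]=)
open import Function.Bundles using (Equivalence; mk⇔)
open import Relation.Binary.Construct.Closure.ReflexiveTransitive using (ε; _◅_; _◅◅_)
open import Relation.Binary.PropositionalEquality using (_≡_; _≢_; ≢-sym; refl; sym; trans; cong; cong₂; subst; subst₂; module ≡-Reasoning)
open import Relation.Nullary using (¬_; Dec; yes; no; does)
open import Relation.Nullary.Decidable using (map′; _×-dec_; dec-true)
open import Relation.Unary using (Pred; Decidable; _⊆_; _≐_)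
open import Relation.Unary.Properties using (≐-sym; ≐-trans)

open import Algebra.Properties.Semiring.Sum +-*-semiring using (sum; ∑-distrib-+; *-distribˡ-sum)

sum-mono-≤ : ∀ {m} {f g : Vector ℕ m} → (∀ i → f i ≤ g i) → sum f ≤ sum g
sum-mono-≤ {zero}  f≤g = z≤n
sum-mono-≤ {suc m} f≤g = +-mono-≤ (f≤g zero) (sum-mono-≤ (λ i → f≤g (suc i)))

indicator : ∀ {m} → Subset m → Vector ℕ m
indicator p i = if lookup p i then 1 else 0

sum-indicator : ∀ {m} (p : Subset m) → sum (indicator p) ≡ ∣ p ∣
sum-indicator []          = refl
sum-indicator (true ∷ p)  = cong suc (sum-indicator p)
sum-indicator (false ∷ p) = sum-indicator p

indicator-∈ : ∀ {m} {p : Subset m} {i} → i ∈ p → indicator p i ≡ 1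
indicator-∈ i∈p rewrite []=⇒lookup i∈p = refl

indicator-∉ : ∀ {m} {p : Subset m} {i} → ¬ i ∈ p → indicator p i ≡ 0
indicator-∉ {p = p} {i} i∉p with lookup p i in eq
... | true  = ⊥-elim (i∉p (lookup⇒[]= i p eq))
... | false = refl

sum-+-scaled-indicator : ∀ {m} (f : Vector ℕ m) t (p : Subset m) →
                         sum (λ i → f i + t * indicator p i) ≡ sum f + t * ∣ p ∣
sum-+-scaled-indicator f t p = begin
  sum (λ i → f i + t * indicator p i)     ≡⟨ ∑-distrib-+ f (λ i → t * indicator p i) ⟩
  sum f + sum (λ i → t * indicator p i)   ≡⟨ cong (sum f +_) (*-distribˡ-sum t (indicator p)) ⟨
  sum f + t * sum (indicator p)           ≡⟨ cong (λ s → sum f + t * s) (sum-indicator p) ⟩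
  sum f + t * ∣ p ∣                       ∎
  where open ≡-Reasoning

decidable⇒Subset : ∀ {m ℓ} {P : Pred (Fin m) ℓ} → Decidable P → Σ (Subset m) λ H → (_∈ H) ≐ P
decidable⇒Subset {m} {P = P} P? = H , ∈H⇒P , P⇒∈H
  where
  H : Subset m
  H = tabulate (λ i → does (P? i))
  lookup-H : ∀ i → lookup H i ≡ does (P? i)
  lookup-H = lookup∘tabulate (λ i → does (P? i))
  ∈H⇒P : (_∈ H) ⊆ P
  ∈H⇒P {i} i∈H with P? i | trans (sym (lookup-H i)) ([]=⇒lookup i∈H)
  ... | yes Pi | _ = Pi
  P⇒∈H : P ⊆ (_∈ H)
  P⇒∈H {i} Pi = lookup⇒[]= i H (trans (lookup-H i) (dec-true (P? i) Pi))

complementary-sizes : ∀ {m} {p q : Subset m} → (∀ {i} → ¬ i ∈ p → i ∈ q) → (∀ {i} → i ∈ q → ¬ i ∈ p) →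
                      ∣ p ∣ + ∣ q ∣ ≡ m
complementary-sizes {m} {p} {q} ∉p⇒∈q ∈q⇒∉p = begin
  ∣ p ∣ + ∣ q ∣        ≡⟨ cong (λ r → ∣ p ∣ + ∣ r ∣) q≡∁p ⟩
  ∣ p ∣ + ∣ ∁ p ∣      ≡⟨ cong (∣ p ∣ +_) (∣∁p∣≡n∸∣p∣ p) ⟩
  ∣ p ∣ + (m ∸ ∣ p ∣)  ≡⟨ m+[n∸m]≡n (∣p∣≤n p) ⟩
  m                    ∎
  where
  open ≡-Reasoning
  q≡∁p : q ≡ ∁ p
  q≡∁p = ⊆-antisym (λ i∈q → x∉p⇒x∈∁p (∈q⇒∉p i∈q)) (λ i∈∁p → ∉p⇒∈q (x∈∁p⇒x∉p i∈∁p))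

equal-parts-balanced : ∀ {s F N} → s + s ≡ N → 2 ≤ F → N ≤ s ⊓ s * F
equal-parts-balanced {s} {F} {N} s+s≡N 2≤F = begin
  N              ≡⟨ s+s≡N ⟨
  s + s          ≡⟨ cong (s +_) (+-identityʳ s) ⟨
  2 * s          ≡⟨ *-comm 2 s ⟩
  s * 2          ≤⟨ *-monoʳ-≤ s 2≤F ⟩
  s * F          ≡⟨ cong (_* F) (⊓-idem s) ⟨
  s ⊓ s * F      ∎
  where open ≤-Reasoning

+≡2-positive : ∀ {a b} → a + b ≡ 2 → a ≢ 0 → b ≢ 0 → a ≡ 1 × b ≡ 1
+≡2-positive {zero}              _  a≢0 _   = ⊥-elim (a≢0 refl)
+≡2-positive {suc zero} {zero}   _  _   b≢0 = ⊥-elim (b≢0 refl)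
+≡2-positive {suc zero} {suc zero} _ _  _   = refl , refl
+≡2-positive {suc (suc _)} {zero} _ _   b≢0 = ⊥-elim (b≢0 refl)
+≡2-positive {suc (suc a)} {suc b} eq _ _   = ⊥-elim (m+1+n≢0 a (suc-injective (suc-injective eq)))

minimiser : ∀ {m} (f : Fin (suc m) → ℕ) → Σ (Fin (suc m)) λ i → ∀ j → f i ≤ f j
minimiser {zero}  f = zero , λ { zero → ≤-refl }
minimiser {suc m} f with minimiser (λ i → f (suc i))
... | i , min with f zero ≤? f (suc i)
...   | yes f0≤ = zero , λ { zero → ≤-refl ; (suc j) → ≤-trans f0≤ (min j) }
...   | no  f0≰ = suc i , λ { zero → <⇒≤ (≰⇒> f0≰) ; (suc j) → min j }

MinimalWitness : Pred ℕ 0ℓ → Set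
MinimalWitness P = Σ ℕ λ m → P m × (∀ j → P j → m ≤ j)

minimal-witness : ∀ {P : Pred ℕ 0ℓ} → Decidable P → ∀ k → P k → MinimalWitness P
minimal-witness {P} P? k Pk with search (suc k)
  where
  search : ∀ b → (∀ j → j < b → ¬ P j) ⊎ MinimalWitness P
  search zero = inj₁ λ _ ()
  search (suc b) with search b
  ... | inj₂ w = inj₂ w
  ... | inj₁ none with P? b
  ...   | yes Pb = inj₂ (b , Pb , λ j Pj → ≮⇒≥ λ j<b → none j j<b Pj)
  ...   | no ¬Pb = inj₁ λ j j≤b Pj → [ (λ j<b → none j j<b Pj) , (λ { refl → ¬Pb Pj }) ]
                                       (m≤n⇒m<n∨m≡n (≤-pred j≤b))
... | inj₁ none = ⊥-elim (none k ≤-refl Pk)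
... | inj₂ w    = w

module Metric {n : ℕ} (G : Graph n) (connected : Connected G) where
  open Graph G using (adj) renaming (sym to adj-sym; irrefl to adj-irrefl)

  V : Set
  V = Fin n

  Adj-sym : ∀ {u v} → Adj G u v → Adj G v u
  Adj-sym {u} {v} = subst T (adj-sym u v)

  Adj⇒≢ : ∀ {u v} → Adj G u v → u ≢ v
  Adj⇒≢ {u} uv refl = adj-irrefl u uv

  _++ʷ_ : ∀ {u w v j k} → Walk G u w j → Walk G w v k → Walk G u v (j + k)
  here       ++ʷ q = q
  step uw p  ++ʷ q = step uw (p ++ʷ q)

  reverseʷ : ∀ {u v k} → Walk G u v k → Walk G v u k
  reverseʷ here = here
  reverseʷ {k = suc k} (step uw p) =
    subst (Walk G _ _) (+-comm k 1) (reverseʷ p ++ʷ step (Adj-sym uw) here)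

  walk? : ∀ k u v → Dec (Walk G u v k)
  walk? zero u v with u ≟ᶠ v
  ... | yes refl = yes here
  ... | no  u≢v  = no λ { here → u≢v refl }
  walk? (suc k) u v =
    map′ (λ { (w , uw , p) → step uw p }) (λ { (step uw p) → _ , uw , p })
         (any? λ w → T? (adj u w) ×-dec walk? k w v)

  private
    shortest : ∀ u v → MinimalWitness (Walk G u v)
    shortest u v = minimal-witness (λ k → walk? k u v) _ (proj₂ (connected u v))

  abstract
    d : V → V → ℕ
    d u v = proj₁ (shortest u v)

    geodesic : ∀ u v → Walk G u v (d u v)
    geodesic u v = proj₁ (proj₂ (shortest u v))

    d-minimal : ∀ {u v k} → Walk G u v k → d u v ≤ k
    d-minimal {u} {v} p = proj₂ (proj₂ (shortest u v)) _ p

  Dist⇒≡d : ∀ {u v k} → Dist G u v k → k ≡ d u v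
  Dist⇒≡d (p , min) = ≤-antisym (min _ (geodesic _ _)) (d-minimal p)

  Dist-d : ∀ u v → Dist G u v (d u v)
  Dist-d u v = geodesic u v , λ _ → d-minimal

  d-sym : ∀ u v → d u v ≡ d v u
  d-sym u v = ≤-antisym (d-minimal (reverseʷ (geodesic v u))) (d-minimal (reverseʷ (geodesic u v)))

  d-triangle : ∀ u w v → d u v ≤ d u w + d w v
  d-triangle u w v = d-minimal (geodesic u w ++ʷ geodesic w v)

  d-refl : ∀ u → d u u ≡ 0
  d-refl u = n≤0⇒n≡0 (d-minimal here)

  d≡0⇒≡ : ∀ {u v} → d u v ≡ 0 → u ≡ v
  d≡0⇒≡ {u} {v} eq with subst (Walk G u v) eq (geodesic u v)
  ... | here = refl

  ≢⇒d≢0 : ∀ {u v} → u ≢ v → d u v ≢ 0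
  ≢⇒d≢0 u≢v eq = u≢v (d≡0⇒≡ eq)

  d≡suc⇒≢ : ∀ {u v k} → d u v ≡ suc k → u ≢ v
  d≡suc⇒≢ {u} eq refl = 0≢1+n (trans (sym (d-refl u)) eq)

  d≡1⇒Adj : ∀ {u v} → d u v ≡ 1 → Adj G u v
  d≡1⇒Adj {u} {v} eq with subst (Walk G u v) eq (geodesic u v)
  ... | step uv here = uv

  Adj⇒d≡1 : ∀ {u v} → Adj G u v → d u v ≡ 1
  Adj⇒d≡1 uv = ≤-antisym (d-minimal (step uv here)) (n≢0⇒n>0 (≢⇒d≢0 (Adj⇒≢ uv)))

  Adj⇒d≤sucˡ : ∀ {u v} → Adj G u v → ∀ z → d u z ≤ suc (d v z)
  Adj⇒d≤sucˡ {u} {v} uv z = ≤-trans (d-triangle u v z) (≤-reflexive (cong (_+ d v z) (Adj⇒d≡1 uv)))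

  Adj⇒d≤sucʳ : ∀ {u v} → Adj G u v → ∀ z → d z u ≤ suc (d z v)
  Adj⇒d≤sucʳ {u} {v} uv z = subst₂ (λ a b → a ≤ suc b) (d-sym u z) (d-sym v z) (Adj⇒d≤sucˡ uv z)

  step-towards : ∀ {u v k} → d u v ≡ suc k → Σ V λ w → Adj G u w × d w v ≡ k
  step-towards {u} {v} {k} eq with subst (Walk G u v) eq (geodesic u v)
  ... | step {w = w} uw p =
    w , uw , ≤-antisym (d-minimal p) (≤-pred (≤-trans (≤-reflexive (sym eq)) (Adj⇒d≤sucˡ uw v)))

  I : V → V → V → Set
  I x y m = d x m + d m y ≡ d x y

  InInterval⇒I : ∀ {x y m} → InInterval G x y m → I x y m
  InInterval⇒I (_ , _ , _ , dxm , dmy , dxy , eq) =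
    trans (sym (cong₂ _+_ (Dist⇒≡d dxm) (Dist⇒≡d dmy))) (trans eq (Dist⇒≡d dxy))

  I⇒InInterval : ∀ {x y m} → I x y m → InInterval G x y m
  I⇒InInterval eq = _ , _ , _ , Dist-d _ _ , Dist-d _ _ , Dist-d _ _ , eq

  I-source : ∀ x y → I x y x
  I-source x y = cong (_+ d x y) (d-refl x)

  I-target : ∀ x y → I x y y
  I-target x y = trans (cong (d x y +_) (d-refl y)) (+-identityʳ (d x y))

  Median : V → V → V → V → Set
  Median x y z m = I x y m × I y z m × I z x m

module MedianGraph {n : ℕ} (G : Graph n) (median : IsMedian G) where
  open Metric G (proj₁ median) public

  median-exists : ∀ x y z → Σ V (Median x y z)
  median-exists x y z with x ≟ᶠ y | y ≟ᶠ z | z ≟ᶠ x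
  ... | yes refl | _ | _ = x , I-source x x , I-source x z , I-target z x
  ... | _ | yes refl | _ = y , I-target x y , I-source y y , I-source y x
  ... | _ | _ | yes refl = z , I-source z y , I-target y z , I-source z z
  ... | no x≢y | no y≢z | no z≢x with proj₂ median x y z x≢y y≢z z≢x
  ...   | m , (xy , yz , zx) , _ = m , InInterval⇒I xy , InInterval⇒I yz , InInterval⇒I zx

  median-unique : ∀ {x y z m m'} → x ≢ y → y ≢ z → z ≢ x →
                  Median x y z m → Median x y z m' → m ≡ m'
  median-unique {x} {y} {z} {m} {m'} x≢y y≢z z≢x (xy , yz , zx) (xy' , yz' , zx') =
    trans (unique m (I⇒InInterval xy , I⇒InInterval yz , I⇒InInterval zx))
          (sym (unique m' (I⇒InInterval xy' , I⇒InInterval yz' , I⇒InInterval zx')))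
    where unique = proj₂ (proj₂ (proj₂ median x y z x≢y y≢z z≢x))

  I-Adj : ∀ {a b m} → Adj G a b → I a b m → m ≡ a ⊎ m ≡ b
  I-Adj {a} {b} {m} ab Iabm with d a m in am
  ... | zero  = inj₁ (sym (d≡0⇒≡ am))
  ... | suc _ = inj₂ (d≡0⇒≡ (m+n≡0⇒n≡0 _ (suc-injective (trans Iabm (Adj⇒d≡1 ab)))))

  Adj⇒d≡suc : ∀ {a b} → Adj G a b → ∀ x → d x b ≡ suc (d x a) ⊎ d x a ≡ suc (d x b)
  Adj⇒d≡suc {a} {b} ab x with median-exists x a b
  ... | m , Ixa , Iab , Ibx with I-Adj ab Iab
  ...   | inj₁ refl = inj₁ (begin
          d x b          ≡⟨ d-sym x b ⟩
          d b x          ≡⟨ Ibx ⟨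
          d b a + d a x  ≡⟨ cong₂ _+_ (Adj⇒d≡1 (Adj-sym ab)) (d-sym a x) ⟩
          suc (d x a)    ∎)
    where open ≡-Reasoning
  ...   | inj₂ refl = inj₂ (trans (sym Ixa) (trans (cong (d x b +_) (Adj⇒d≡1 (Adj-sym ab))) (+-comm (d x b) 1)))

  W : V → V → Pred V 0ℓ
  W a b x = d x a < d x b

  W⇒d≡suc : ∀ {a b} → Adj G a b → ∀ {x} → W a b x → d x b ≡ suc (d x a)
  W⇒d≡suc ab {x} wx with Adj⇒d≡suc ab x
  ... | inj₁ eq = eq
  ... | inj₂ eq = ⊥-elim (<-asym wx (≤-reflexive (sym eq)))

  W-split : ∀ {a b} → Adj G a b → ∀ x → W a b x ⊎ W b a x
  W-split ab x with Adj⇒d≡suc ab x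
  ... | inj₁ eq = inj₁ (≤-reflexive (sym eq))
  ... | inj₂ eq = inj₂ (≤-reflexive (sym eq))

  W-disjoint : ∀ {a b x} → W a b x → ¬ W b a x
  W-disjoint = <-asym

  W-source : ∀ {a b} → Adj G a b → W a b a
  W-source {a} ab = subst₂ _<_ (sym (d-refl a)) (sym (Adj⇒d≡1 ab)) ≤-refl

  W-closer : ∀ {a b x x'} → Adj G x x' → W a b x → d x' a < d x a → W a b x'
  W-closer {b = b} xx' wx x'a<xa = <-≤-trans x'a<xa (≤-pred (≤-trans wx (Adj⇒d≤sucˡ xx' b)))

  crossing-distance : ∀ {a b x y} → Adj G a b → Adj G x y → W a b x → W b a y → d x a ≡ d y b
  crossing-distance {a} {b} {x} {y} ab xy wx wy = ≤-antisym
    (≤-pred (≤-trans (≤-reflexive (sym (W⇒d≡suc ab wx))) (Adj⇒d≤sucˡ xy b)))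
    (≤-pred (≤-trans (≤-reflexive (sym (W⇒d≡suc (Adj-sym ab) wy))) (Adj⇒d≤sucˡ (Adj-sym xy) a)))

  no-triangle : ∀ {u v w} → Adj G u v → Adj G v w → Adj G w u → ⊥
  no-triangle {u} {v} {w} uv vw wu = [ 1≢2 wv wu' , 1≢2 wu' wv ] (Adj⇒d≡suc uv w)
    where
    wv : d w v ≡ 1
    wv = trans (d-sym w v) (Adj⇒d≡1 vw)
    wu' : d w u ≡ 1
    wu' = Adj⇒d≡1 wu
    1≢2 : ∀ {i j} → i ≡ 1 → j ≡ 1 → i ≢ suc j
    1≢2 refl refl ()

  common-neighbour-d≡2 : ∀ {u v w} → Adj G u v → Adj G u w → v ≢ w → d v w ≡ 2
  common-neighbour-d≡2 {u} {v} {w} uv uw v≢w = ≤-antisym upper lower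
    where
    upper : d v w ≤ 2
    upper = ≤-trans (d-triangle v u w) (≤-reflexive (cong₂ _+_ (Adj⇒d≡1 (Adj-sym uv)) (Adj⇒d≡1 uw)))
    lower : 2 ≤ d v w
    lower with d v w in vw
    ... | zero        = ⊥-elim (v≢w (d≡0⇒≡ vw))
    ... | suc zero    = ⊥-elim (no-triangle uv (d≡1⇒Adj vw) (Adj-sym uw))
    ... | suc (suc _) = s≤s (s≤s z≤n)

  quadrangle : ∀ {u w z k} → d u w ≡ 2 → d u z ≡ suc k → d w z ≡ suc k →
               Σ V λ m → Adj G u m × Adj G m w × d m z ≡ k
  quadrangle {u} {w} {z} {k} uw uz wz with median-exists u w z
  ... | m , Iuw , Iwz , Izu = m , d≡1⇒Adj um , d≡1⇒Adj mw , suc-injective mz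
    where
    open ≡-Reasoning
    um≢0 : d u m ≢ 0
    um≢0 eq with d≡0⇒≡ eq
    ... | refl = m+1+n≢n 1 (begin
      2 + suc k      ≡⟨ cong₂ _+_ (trans (d-sym w u) uw) uz ⟨
      d w u + d u z  ≡⟨ Iwz ⟩
      d w z          ≡⟨ wz ⟩
      suc k          ∎)
    mw≢0 : d m w ≢ 0
    mw≢0 eq with d≡0⇒≡ eq
    ... | refl = m+1+n≢m (suc k) (begin
      suc k + 2      ≡⟨ cong₂ _+_ (trans (d-sym z w) wz) (trans (d-sym w u) uw) ⟨
      d z m + d m u  ≡⟨ Izu ⟩
      d z u          ≡⟨ trans (d-sym z u) uz ⟩
      suc k          ∎)
    um : d u m ≡ 1
    um = proj₁ (+≡2-positive (trans Iuw uw) um≢0 mw≢0)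
    mw : d m w ≡ 1
    mw = proj₂ (+≡2-positive (trans Iuw uw) um≢0 mw≢0)
    mz : suc (d m z) ≡ suc k
    mz = trans (cong (_+ d m z) (sym (trans (d-sym w m) mw))) (trans Iwz wz)

  quadrangle-median : ∀ {u w z m k} → d u w ≡ 2 → Adj G u m → Adj G m w →
                      d m z ≡ k → d u z ≡ suc k → d w z ≡ suc k → Median u w z m
  quadrangle-median {u} {w} {z} {m} {k} uw um mw mz uz wz =
    trans (cong₂ _+_ (Adj⇒d≡1 um) (Adj⇒d≡1 mw)) (sym uw) ,
    trans (cong₂ _+_ (Adj⇒d≡1 (Adj-sym mw)) mz) (sym wz) ,
    trans (cong₂ _+_ (trans (d-sym z m) mz) (Adj⇒d≡1 (Adj-sym um))) (trans (+-comm k 1) (sym (trans (d-sym z u) uz)))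

  square : ∀ {u v x y} (uv : Adj G u v) (xy : Adj G x y) → Adj G v y → Adj G x u →
           u ≢ y → v ≢ x → Θ₀ G (u , v , uv) (x , y , xy)
  square uv xy vy xu u≢y v≢x =
    vy , Adj-sym xy , xu , Adj⇒≢ uv , u≢y , ≢-sym (Adj⇒≢ xu) , Adj⇒≢ vy , v≢x , ≢-sym (Adj⇒≢ xy)

  Θ₀-sym : ∀ {e e'} → Θ₀ G e e' → Θ₀ G e' e
  Θ₀-sym {_ , _ , uv} {_ , _ , xy} (vy , _ , xu , _ , u≢y , _ , _ , v≢x , _) =
    square xy uv (Adj-sym vy) (Adj-sym xu) (≢-sym v≢x) (≢-sym u≢y)

  -- In the last case u and y would be two distinct medians of v, x and z.
  Θ₀⇒W⊆W : ∀ {u v x y} {uv : Adj G u v} {xy : Adj G x y} →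
           Θ₀ G (u , v , uv) (x , y , xy) → W u v ⊆ W x y
  Θ₀⇒W⊆W {u} {v} {x} {y} {uv} {xy} (vy , _ , xu , _ , u≢y , _ , _ , v≢x , _) {z} wz
    with Adj⇒d≡suc xu z | Adj⇒d≡suc xy z
  ... | _       | inj₁ zy  = ≤-reflexive (sym zy)
  ... | inj₁ zu | inj₂ zx  = ⊥-elim (m+n≮n 1 (d z y) (≤-pred (begin
          3 + d z y   ≡⟨ cong suc (trans zu (cong suc zx)) ⟨
          suc (d z u) ≡⟨ W⇒d≡suc uv wz ⟨
          d z v      ≤⟨ Adj⇒d≤sucʳ vy z ⟩
          suc (d z y) ∎)))
    where open ≤-Reasoning
  ... | inj₂ zx | inj₂ zx' = ⊥-elim (u≢y (median-unique v≢x (≢-sym (d≡suc⇒≢ zx)) (d≡suc⇒≢ zv)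
          (quadrangle-median vx (Adj-sym uv) (Adj-sym xu) (d-sym u z) zv' (trans (d-sym x z) zx))
          (quadrangle-median vx vy (Adj-sym xy) (trans (d-sym y z) zy) zv' (trans (d-sym x z) zx))))
    where
    zv : d z v ≡ suc (d z u)
    zv = W⇒d≡suc uv wz
    zv' : d v z ≡ suc (d z u)
    zv' = trans (d-sym v z) zv
    zy : d z y ≡ d z u
    zy = suc-injective (trans (sym zx') zx)
    vx : d v x ≡ 2
    vx = common-neighbour-d≡2 uv (Adj-sym xu) v≢x

  W⁺ W⁻ : Edge G → Pred V 0ℓ
  W⁺ (a , b , _) = W a b
  W⁻ (a , b , _) = W b a

  flipᴱ : Edge G → Edge G
  flipᴱ (a , b , ab) = b , a , Adj-sym ab

  W⁺-disjoint-W⁻ : ∀ {e x} → W⁺ e x → ¬ W⁻ e x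
  W⁺-disjoint-W⁻ {_ , _ , _} = W-disjoint

  W⁺⊇⇒W⁻⊆ : ∀ {e e'} → W⁺ e' ⊆ W⁺ e → W⁻ e ⊆ W⁻ e'
  W⁺⊇⇒W⁻⊆ {_ , _ , _} {_ , _ , xy} W⁺e'⊆W⁺e {z} w⁻ with W-split xy z
  ... | inj₁ w⁺  = ⊥-elim (W-disjoint (W⁺e'⊆W⁺e w⁺) w⁻)
  ... | inj₂ w⁻' = w⁻'

  W⁺≐⇒W⁻≐ : ∀ {e e'} → W⁺ e ≐ W⁺ e' → W⁻ e ≐ W⁻ e'
  W⁺≐⇒W⁻≐ {e} {e'} (to , from) = W⁺⊇⇒W⁻⊆ {e} {e'} from , W⁺⊇⇒W⁻⊆ {e'} {e} to

  SameCut : Edge G → Edge G → Set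
  SameCut e e' = W⁺ e ≐ W⁺ e' ⊎ W⁺ e ≐ W⁻ e'

  SameCut-sym : ∀ {e e'} → SameCut e e' → SameCut e' e
  SameCut-sym         (inj₁ eq) = inj₁ (≐-sym eq)
  SameCut-sym {e} {e'} (inj₂ eq) = inj₂ (≐-sym (W⁺≐⇒W⁻≐ {e} {flipᴱ e'} eq))

  SameCut-trans : ∀ {e e' e''} → SameCut e e' → SameCut e' e'' → SameCut e e''
  SameCut-trans                (inj₁ p) (inj₁ q) = inj₁ (≐-trans p q)
  SameCut-trans                (inj₁ p) (inj₂ q) = inj₂ (≐-trans p q)
  SameCut-trans {e' = e'} {e''} (inj₂ p) (inj₁ q) = inj₂ (≐-trans p (W⁺≐⇒W⁻≐ {e'} {e''} q))
  SameCut-trans {e' = e'} {e''} (inj₂ p) (inj₂ q) = inj₁ (≐-trans p (W⁺≐⇒W⁻≐ {e'} {flipᴱ e''} q))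

  Step⇒SameCut : ∀ {e e'} → Step G e e' → SameCut e e'
  Step⇒SameCut {e@(u , v , uv)} {e'@(x , y , xy)} (θ₀ sq) =
    inj₁ (Θ₀⇒W⊆W {uv = uv} {xy} sq , Θ₀⇒W⊆W {uv = xy} {uv} (Θ₀-sym {e} {e'} sq))
  Step⇒SameCut {_ , _ , _} {_ , _ , _} (rev (refl , refl))  = inj₂ ((λ w → w) , (λ w → w))

  Θ⇒SameCut : ∀ {e e'} → Θ G e e' → SameCut e e'
  Θ⇒SameCut ε       = inj₁ ((λ w → w) , (λ w → w))
  Θ⇒SameCut {e} {e''} (_◅_ {j = e'} s θ) = SameCut-trans {e} {e'} {e''} (Step⇒SameCut s) (Θ⇒SameCut θ)

  SameCut-separates : ∀ {e e' s t} → SameCut e e' → W⁺ e s → W⁺ e t → W⁺ e' s → W⁻ e' t → ⊥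
  SameCut-separates {e' = e'} (inj₁ (to , _)) _  w⁺t _    w⁻'t = W⁺-disjoint-W⁻ {e'} (to w⁺t) w⁻'t
  SameCut-separates {e' = e'} (inj₂ (to , _)) w⁺s _  w⁺'s _    = W⁺-disjoint-W⁻ {e'} w⁺'s (to w⁺s)

  crossing-square : ∀ {a b x y k} (ab : Adj G a b) (xy : Adj G x y) →
                    W a b x → W b a y → d x a ≡ suc k →
                    Σ V λ x' → Σ V λ m → Σ (Adj G x' m) λ x'm →
                      d x' a ≡ k × W a b x' × W b a m × Θ₀ G (x' , m , x'm) (x , y , xy)
  crossing-square {a} {b} {x} {y} {k} ab xy wx wy xa with step-towards xa
  ... | x' , xx' , x'a =
    let m , x'm , my , mb = quadrangle x'y x'b yb
    in  x' , m , x'm , x'a , wx' , W-closer (Adj-sym my) wy (closer mb yb) , square x'm xy my xx' x'≢y (≢x mb)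
    where
    closer : ∀ {i j} → i ≡ k → j ≡ suc k → i < j
    closer refl refl = ≤-refl
    xb : d x b ≡ suc (suc k)
    xb = trans (W⇒d≡suc ab wx) (cong suc xa)
    yb : d y b ≡ suc k
    yb = trans (sym (crossing-distance ab xy wx wy)) xa
    ya : d y a ≡ suc (suc k)
    ya = trans (W⇒d≡suc (Adj-sym ab) wy) (cong suc yb)
    wx' : W a b x'
    wx' = W-closer xx' wx (closer x'a xa)
    x'b : d x' b ≡ suc k
    x'b = trans (W⇒d≡suc ab wx') (cong suc x'a)
    x'≢y : x' ≢ y
    x'≢y refl = m+1+n≢n 1 (trans (sym ya) x'a)
    x'y : d x' y ≡ 2
    x'y = common-neighbour-d≡2 xx' xy x'≢y
    ≢x : ∀ {m} → d m b ≡ k → m ≢ x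
    ≢x mb refl = m+1+n≢n 1 (trans (sym xb) mb)

  crossing⇒Θ : ∀ {a b x y} (ab : Adj G a b) (xy : Adj G x y) →
               W a b x → W b a y → Θ G (a , b , ab) (x , y , xy)
  crossing⇒Θ {a} {b} {x} ab xy wx wy = by-distance (d x a) xy refl wx wy
    where
    by-distance : ∀ k {x y} (xy : Adj G x y) → d x a ≡ k → W a b x → W b a y →
                  Θ G (a , b , ab) (x , y , xy)
    by-distance zero xy xa wx wy
      with d≡0⇒≡ xa | d≡0⇒≡ (trans (sym (crossing-distance ab xy wx wy)) xa)
    ... | refl | refl = subst (λ ab' → Θ G (a , b , ab) (a , b , ab')) (T-irrelevant ab xy) ε
    by-distance (suc k) xy xa wx wy with crossing-square ab xy wx wy xa
    ... | _ , _ , x'm , x'a , wx' , wm , sq = by-distance k x'm x'a wx' wm ◅◅ (θ₀ sq ◅ ε)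

  Convex : Pred V 0ℓ → Set
  Convex C = ∀ {x y z} → C x → C y → I x y z → C z

  I-step-towards : ∀ {x x' y z k} → Adj G x x' → d x z ≡ suc k → d x' z ≡ k →
                   I x y z → I x' y z × d x' y < d x y
  I-step-towards {x} {x'} {y} {z} {k} xx' xz x'z Ixyz = Ix'yz , x'y<xy
    where
    open ≤-Reasoning
    x'y≤ : d x' y ≤ k + d z y
    x'y≤ = ≤-trans (d-triangle x' z y) (≤-reflexive (cong (_+ d z y) x'z))
    ≤x'y : k + d z y ≤ d x' y
    ≤x'y = ≤-pred (begin
      suc k + d z y  ≡⟨ cong (_+ d z y) xz ⟨
      d x z + d z y  ≡⟨ Ixyz ⟩
      d x y          ≤⟨ Adj⇒d≤sucˡ xx' y ⟩
      suc (d x' y)   ∎)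
    Ix'yz : I x' y z
    Ix'yz = trans (cong (_+ d z y) x'z) (≤-antisym ≤x'y x'y≤)
    x'y<xy : d x' y < d x y
    x'y<xy = begin-strict
      d x' y         ≤⟨ x'y≤ ⟩
      k + d z y      <⟨ ≤-refl ⟩
      suc k + d z y  ≡⟨ cong (_+ d z y) xz ⟨
      d x z + d z y  ≡⟨ Ixyz ⟩
      d x y          ∎

  W-convex : ∀ {a b} → Adj G a b → Convex (W a b)
  W-convex {a} {b} ab {x} {y} {z} wx wy Ixyz = by-distance (d x z) refl wx Ixyz
    where
    by-distance : ∀ k {x} → d x z ≡ k → W a b x → I x y z → W a b z
    by-distance zero    xz wx _    = subst (W a b) (d≡0⇒≡ xz) wx
    by-distance (suc k) {x} xz wx Ixyz with step-towards xz
    ... | x' , xx' , x'z with I-step-towards xx' xz x'z Ixyz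
    ...   | Ix'yz , x'y<xy = by-distance k x'z wx' Ix'yz
      where
      -- An edge from x out of W a b would separate x from y, so it cannot be Θ-related to ab.
      wx' : W a b x'
      wx' with W-split ab x'
      ... | inj₁ w = w
      ... | inj₂ w = ⊥-elim (SameCut-separates {a , b , ab} {x , x' , xx'} (Θ⇒SameCut (crossing⇒Θ ab xx' wx w))
                       wx wy (W-source xx') (subst₂ _<_ (d-sym x' y) (d-sym x y) x'y<xy))

  component≐W : ∀ {c a b} (ab : Adj G a b) → Θ G c (a , b , ab) → ReachMinus G c a ≐ W a b
  component≐W {c} {a} {b} ab θ = (λ r → reach⇒W r (W-source ab)) , by-distance (d _ a) refl
    where
    reach⇒W : ∀ {u x} → ReachMinus G c u x → W a b u → W a b x
    reach⇒W ε wu = wu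
    reach⇒W (_◅_ {j = w} (uw , ¬θ) r) wu with W-split ab w
    ... | inj₁ ww = reach⇒W r ww
    ... | inj₂ ww = ⊥-elim (¬θ (θ ◅◅ crossing⇒Θ ab uw wu ww))
    by-distance : ∀ k {x} → d x a ≡ k → W a b x → ReachMinus G c a x
    by-distance zero    xa _  = subst (ReachMinus G c a) (sym (d≡0⇒≡ xa)) ε
    by-distance (suc k) {x} xa wx with step-towards xa
    ... | x' , xx' , x'a = by-distance k x'a wx' ◅◅ ((Adj-sym xx' , ¬θ) ◅ ε)
      where
      wx' : W a b x'
      wx' = W-closer xx' wx (≤-reflexive (trans (cong suc x'a) (sym xa)))
      ¬θ : ¬ Θ G c (x' , x , Adj-sym xx')
      ¬θ θ' = SameCut-separates {a , b , ab} {x' , x , Adj-sym xx'}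
                (SameCut-trans {a , b , ab} {c} {x' , x , Adj-sym xx'}
                  (SameCut-sym {c} {a , b , ab} (Θ⇒SameCut θ)) (Θ⇒SameCut θ'))
                wx' wx (W-source (Adj-sym xx')) (W-source xx')

  IsComponent⇒≐W : ∀ {c a b} {H : Subset n} (ab : Adj G a b) → Θ G c (a , b , ab) →
                   IsComponent G c a H → (_∈ H) ≐ W a b
  IsComponent⇒≐W {c} {a} {H = H} ab θ comp = ≐-trans H≐reach (component≐W ab θ)
    where
    H≐reach : (_∈ H) ≐ ReachMinus G c a
    H≐reach = (λ {x} → Equivalence.to (comp x)) , (λ {x} → Equivalence.from (comp x))

  ≐W⇒IsComponent : ∀ {c a b} {H : Subset n} (ab : Adj G a b) → Θ G c (a , b , ab) →
                   (_∈ H) ≐ W a b → IsComponent G c a H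
  ≐W⇒IsComponent ab θ H≐W x with ≐-trans H≐W (≐-sym (component≐W ab θ))
  ... | to , from = mk⇔ to from

  -- The gate q is a point of C nearest to v; the median of v, q, u lies in C by convexity,
  -- hence is no farther from v than q, hence equals q.
  gated : ∀ {C : Pred V 0ℓ} → Decidable C → Convex C → ∀ {c} → C c → ∀ v →
          Σ V λ q → C q × (∀ {u} → C u → d v u ≡ d v q + d q u)
  gated {C} C? convex {c} Cc v with minimal-witness reach? (d v c) (c , Cc , refl)
    where
    reach? : Decidable (λ t → Σ V λ u → C u × d v u ≡ t)
    reach? t = any? λ u → C? u ×-dec (d v u ≟ t)
  ... | _ , (q , Cq , refl) , nearest = q , Cq , through-q
    where
    no-nearer : ∀ {m} → C m → I v q m → m ≡ q
    no-nearer {m} Cm Ivq = d≡0⇒≡ (n≤0⇒n≡0 (+-cancelˡ-≤ (d v m) _ 0 (begin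
      d v m + d m q  ≡⟨ Ivq ⟩
      d v q          ≤⟨ nearest _ (m , Cm , refl) ⟩
      d v m          ≡⟨ +-identityʳ (d v m) ⟨
      d v m + 0      ∎)))
      where open ≤-Reasoning
    through-q : ∀ {u} → C u → d v u ≡ d v q + d q u
    through-q {u} Cu with median-exists v q u
    ... | m , Ivq , Iqu , Iuv with no-nearer (convex Cq Cu Iqu) Ivq
    ... | refl = begin
      d v u          ≡⟨ d-sym v u ⟩
      d u v          ≡⟨ Iuv ⟨
      d u m + d m v  ≡⟨ +-comm (d u m) (d m v) ⟩
      d m v + d u m  ≡⟨ cong₂ _+_ (d-sym m v) (d-sym u m) ⟩
      d v m + d m u  ∎
      where open ≡-Reasoning

  W? : ∀ a b → Decidable (W a b)
  W? a b x = d x a <? d x b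

  total-distance : V → ℕ
  total-distance v = sum (d v)

  Halfspaces : V → V → Subset n → Subset n → Set
  Halfspaces a b H' H'' = (_∈ H') ≐ W a b × (_∈ H'') ≐ W b a

  halfspace-sizes : ∀ {a b H' H''} → Adj G a b → Halfspaces a b H' H'' → ∣ H' ∣ + ∣ H'' ∣ ≡ n
  halfspace-sizes {a} {b} ab ((H'⊆ , ⊆H') , (H''⊆ , ⊆H'')) = complementary-sizes ∉H'⇒∈H'' ∈H''⇒∉H'
    where
    ∉H'⇒∈H'' : ∀ {x} → ¬ x ∈ _ → x ∈ _
    ∉H'⇒∈H'' {x} x∉H' with W-split ab x
    ... | inj₁ w = ⊥-elim (x∉H' (⊆H' w))
    ... | inj₂ w = ⊆H'' w
    ∈H''⇒∉H' : ∀ {x} → x ∈ _ → ¬ x ∈ _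
    ∈H''⇒∉H' x∈H'' x∈H' = W-disjoint (H'⊆ x∈H') (H''⊆ x∈H'')

  minority-not-central : ∀ {a b H' H''} → Adj G a b → Halfspaces a b H' H'' → ∣ H' ∣ < ∣ H'' ∣ →
                         ∀ {v} → W a b v → Σ V λ q → total-distance q < total-distance v
  minority-not-central {a} {b} {H'} {H''} ab ((H'⊆ , ⊆H') , (H''⊆ , ⊆H'')) H'<H'' {v} wv
    with gated (W? b a) (W-convex (Adj-sym ab)) (W-source (Adj-sym ab)) v
  ... | q , wq , through-q = q , +-cancelʳ-< (t * ∣ H'' ∣) (total-distance q) (total-distance v) (begin-strict
      total-distance q + t * ∣ H'' ∣  ≡⟨ sum-+-scaled-indicator (d q) t H'' ⟨
      sum (λ u → d q u + t * indicator H'' u)  ≤⟨ sum-mono-≤ pointwise ⟩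
      sum (λ u → d v u + t * indicator H' u)   ≡⟨ sum-+-scaled-indicator (d v) t H' ⟩
      total-distance v + t * ∣ H' ∣   <⟨ +-monoʳ-< (total-distance v) (*-monoʳ-< t H'<H'') ⟩
      total-distance v + t * ∣ H'' ∣  ∎)
    where
    open ≤-Reasoning
    t : ℕ
    t = d v q
    instance
      t≢0 : NonZero t
      t≢0 = ≢-nonZero (≢⇒d≢0 λ { refl → W-disjoint wv wq })
    pointwise : ∀ u → d q u + t * indicator H'' u ≤ d v u + t * indicator H' u
    pointwise u with W-split ab u
    ... | inj₁ w rewrite indicator-∉ {p = H''} (λ u∈H'' → W-disjoint w (H''⊆ u∈H''))
                       | indicator-∈ {p = H'} (⊆H' w) | *-zeroʳ t | *-identityʳ t | +-identityʳ (d q u) =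
      ≤-trans (d-triangle q v u) (≤-reflexive (trans (cong (_+ d v u) (d-sym q v)) (+-comm t (d v u))))
    ... | inj₂ w rewrite indicator-∈ {p = H''} (⊆H'' w)
                       | indicator-∉ {p = H'} (λ u∈H' → W-disjoint (H'⊆ u∈H') w)
                       | *-zeroʳ t | *-identityʳ t | +-identityʳ (d v u) =
      ≤-reflexive (trans (+-comm (d q u) t) (sym (through-q w)))

  Halfspaces-swap : ∀ {a b H' H''} → Halfspaces a b H' H'' → Halfspaces b a H'' H'
  Halfspaces-swap (H'≐ , H''≐) = H''≐ , H'≐

  IsComponent⇒Halfspaces : ∀ {a b H' H''} (ab : Adj G a b) →
    IsComponent G (a , b , ab) a H' → IsComponent G (a , b , ab) b H'' → Halfspaces a b H' H''
  IsComponent⇒Halfspaces ab c' c'' =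
    IsComponent⇒≐W ab ε c' , IsComponent⇒≐W (Adj-sym ab) (rev (refl , refl) ◅ ε) c''

  Halfspaces⇒IsComponent : ∀ {a b H' H''} (ab : Adj G a b) → Halfspaces a b H' H'' →
    IsComponent G (a , b , ab) a H' × IsComponent G (a , b , ab) b H''
  Halfspaces⇒IsComponent ab (H'≐ , H''≐) =
    ≐W⇒IsComponent ab ε H'≐ , ≐W⇒IsComponent (Adj-sym ab) (rev (refl , refl) ◅ ε) H''≐

  Central : V → Set
  Central v = ∀ u → total-distance v ≤ total-distance u

  central-in-majority : ∀ {a b H' H'' v} → Central v → Adj G a b → Halfspaces a b H' H'' →
                        ∣ H' ∣ < ∣ H'' ∣ → v ∈ H''
  central-in-majority {v = v} central ab hs@(_ , (_ , ⊆H'')) H'<H'' with W-split ab v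
  ... | inj₂ w = ⊆H'' w
  ... | inj₁ w with minority-not-central ab hs H'<H'' w
  ...   | q , q<v = ⊥-elim (<⇒≱ q<v (central q))

  central⇒InMajority : ∀ {v} → Central v → ∀ e → InMajority G e v
  central⇒InMajority central (a , b , ab) H' H'' c' c'' =
    central-in-majority central ab hs , central-in-majority central (Adj-sym ab) (Halfspaces-swap hs)
    where hs = IsComponent⇒Halfspaces ab c' c''

  InMajority⇒not-minority : ∀ {a b v H' H''} (ab : Adj G a b) → InMajority G (a , b , ab) v →
    Halfspaces a b H' H'' → (W a b v → ¬ ∣ H' ∣ < ∣ H'' ∣) × (W b a v → ¬ ∣ H'' ∣ < ∣ H' ∣)
  InMajority⇒not-minority {H' = H'} {H''} ab majority hs@((H'⊆ , _) , (H''⊆ , _))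
    with Halfspaces⇒IsComponent ab hs
  ... | c' , c'' = (λ w H'<H'' → W-disjoint w (H''⊆ (proj₁ (majority H' H'' c' c'') H'<H'')))
                 , (λ w H''<H' → W-disjoint w (H'⊆ (proj₂ (majority H' H'' c' c'') H''<H')))

  first-edge : ∀ {v v'} → v ≢ v' → Σ V λ w → Σ (Adj G v w) λ _ → W w v v'
  first-edge {v} {v'} v≢v' with d v v' in vv'
  ... | zero  = ⊥-elim (v≢v' (d≡0⇒≡ vv'))
  ... | suc k with step-towards vv'
  ...   | w , vw , wv' = w , vw , subst₂ _<_ (sym (trans (d-sym v' w) wv')) (sym (trans (d-sym v' v) vv')) ≤-refl

  InMajority-unique : (f : ℕ → ℕ) → 2 ≤ f n → (∀ e → Unbalanced G f e) →
                      ∀ {v v'} → (∀ e → InMajority G e v) → (∀ e → InMajority G e v') → v ≡ v'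
  InMajority-unique f 2≤f unbalanced {v} {v'} v-majority v'-majority with v ≟ᶠ v'
  ... | yes v≡v' = v≡v'
  ... | no  v≢v' with first-edge v≢v'
  ...   | w , vw , v'∈Wwv with decidable⇒Subset (W? v w) | decidable⇒Subset (W? w v)
  ...     | H' , H'≐ | H'' , H''≐ with Halfspaces⇒IsComponent vw (H'≐ , H''≐)
  ...       | c' , c'' = ⊥-elim (<⇒≱ (unbalanced (v , w , vw) H' H'' c' c'') (begin
    n                      ≤⟨ equal-parts-balanced {∣ H' ∣} (trans (cong (∣ H' ∣ +_) H'≡H'') sizes) 2≤f ⟩
    ∣ H' ∣ ⊓ ∣ H' ∣ * f n   ≡⟨ cong (λ h → ∣ H' ∣ ⊓ h * f n) H'≡H'' ⟩
    ∣ H' ∣ ⊓ ∣ H'' ∣ * f n  ∎))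
    where
    open ≤-Reasoning
    sizes : ∣ H' ∣ + ∣ H'' ∣ ≡ n
    sizes = halfspace-sizes vw (H'≐ , H''≐)
    H'≡H'' : ∣ H' ∣ ≡ ∣ H'' ∣
    H'≡H'' = ≤-antisym (≮⇒≥ (proj₂ (InMajority⇒not-minority vw (v'-majority _) (H'≐ , H''≐)) v'∈Wwv))
                       (≮⇒≥ (proj₁ (InMajority⇒not-minority vw (v-majority _) (H'≐ , H''≐)) (W-source vw)))

lemma17 : (n : ℕ) → 1 ≤ n → (G : Graph n) → IsMedian G →
    (f : ℕ → ℕ) → 2 ≤ f n →
    (∀ e → Unbalanced G f e) →
    Σ (Fin n) λ v₀ → (∀ e → InMajority G e v₀) ×
      (∀ v → (∀ e → InMajority G e v) → v ≡ v₀)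
lemma17 (suc _) _ G median f 2≤f unbalanced =
  v₀ , v₀-majority , λ v v-majority → InMajority-unique f 2≤f unbalanced v-majority v₀-majority
  where
  open MedianGraph G median
  v₀ : V
  v₀ = proj₁ (minimiser total-distance)
  v₀-majority : ∀ e → InMajority G e v₀
  v₀-majority = central⇒InMajority (proj₂ (minimiser total-distance))
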